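{- Let $K$ be a $k$-dimensional cubical complex. If the vertex-edge graph of $K$ is bipartite (i.e. the vertices of $K$ can be colored with two colors so that adjacent vertices always receive different colors), then $I(K)=0$.
   Context: A cubical complex is a regular CW-complex $K$ whose face poset $P_K$ is cubical: (a) for every $x\in P_K$ the lower interval $(P_K)_{\le x}$ is isomorphic to the face poset of a cube $I^q$, and (b) any pair $x,y\in P_K$ bounded from above has a least upper bound. For a $k$-dimensional cubical complex $K$, the groupoid $\mathcal{C}(K)$ has as objects the $k$-dimensional cells of $K$. If two $k$-cells $\sigma_1,\sigma_2$ share a common $(k-1)$-dimensional face $\delta$, an elementary morphism $\sigma_1\to\sigma_2$ is an isomorphism of the face posets of $\sigma_1$ and $\sigma_2$ that fixes every face of $\delta$ (i.e. fixes $\delta$ pointwise); a morphism $\sigma_0\to\sigma_m$ is a poset isomorphism expressible as a composition of elementary morphisms. The holonomy group $\Pi(K,\sigma)=\mathrm{Hom}_{\mathcal{C}(K)}(\sigma,\sigma)$ is a subgroup of $B_k$, the group of all symmetries (face-poset automorphisms) of the $k$-cube. The vertex-edge graph of a $k$-cube is bipartite; $B_k^{even}\subset B_k$ denotes the subgroup of symmetries preserving this two-coloring of the vertices of the cube (equivalently, signed permutation matrices with an even number of $-1$ entries). The invariant $I(K)\in\{0,1\}$ is defined by $I(K)=0$ if $\Pi(K,\sigma)\subset B_k^{even}$ for all $k$-cells $\sigma$, and $I(K)=1$ otherwise. -}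

module Defs where

open import Level using (Level; _⊔_) renaming (suc to lsuc)
open import Data.Nat using (ℕ; zero; suc; _+_; _%_) renaming (_≤_ to _≤ℕ_)
open import Data.Fin using (Fin) renaming (zero to fz; suc to fs)
open import Data.Bool using (Bool)
open import Data.Product using (Σ; ∃; _×_; _,_)
open import Data.Sum using (_⊎_)
open import Function using (id; _∘_)
open import Relation.Binary.PropositionalEquality using (_≡_; _≢_)
open import Relation.Binary.Structures using (IsPartialOrder)

-- The face poset of the q-cube I^q = [0,1]^q.
-- A (nonempty) face is a word in {0,1,*}^q; the face x lies in the
-- face y iff for each coordinate i, y i = * or x i = y i.

data Tri : Set where
  t0 t1 star : Tri

CubeFace : ℕ → Set
CubeFace q = Fin q → Tri

_≤ᶜ_ : ∀ {q} → CubeFace q → CubeFace q → Set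
_≤ᶜ_ {q} x y = (i : Fin q) → (y i ≡ star) ⊎ (x i ≡ y i)

IsCubeVertex : ∀ {q} → CubeFace q → Set
IsCubeVertex {q} v = (i : Fin q) → v i ≢ star

ones : ∀ {q} → CubeFace q → ℕ
ones {zero} v = zero
ones {suc q} v with v fz
... | t1 = suc (ones (v ∘ fs))
... | _  = ones (v ∘ fs)

-- The two-colouring of the vertices of the cube (bipartite vertex-edge
-- graph): colour of a vertex = parity of its number of 1-coordinates.
-- A symmetry is "even" (in B_q^even) iff it preserves this colouring.
IsEvenSymmetry : ∀ {q} → (CubeFace q → CubeFace q) → Set
IsEvenSymmetry {q} g =
  (v : CubeFace q) → IsCubeVertex v → ones (g v) % 2 ≡ ones v % 2

IsCubeIso : ∀ {p q} → (CubeFace p → CubeFace q) → Set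
IsCubeIso {p} {q} h =
  ((x y : CubeFace p) → (x ≤ᶜ y → h x ≤ᶜ h y) × (h x ≤ᶜ h y → x ≤ᶜ y))
  × ((z : CubeFace q) → ∃ λ x → h x ≡ z)

-- Cubical complexes, given through their face posets (a regular CW
-- complex is determined by its face poset, and every poset whose lower
-- intervals are face posets of cubes is the face poset of a regular CW
-- complex).  Each cell x comes with a chart: an isomorphism
-- face x : CubeFace (dim x) ≅ (P_K)_{≤ x}.

record CubicalComplex (c ℓ : Level) : Set (lsuc (c ⊔ ℓ)) where
  field
    Cell   : Set c
    _≤_    : Cell → Cell → Set ℓ
    isPartialOrder : IsPartialOrder _≡_ _≤_
    dim    : Cell → ℕ
    face   : (x : Cell) → CubeFace (dim x) → Cell
    face-≤     : (x : Cell) (a : CubeFace (dim x)) → face x a ≤ x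
    face-onto  : (x y : Cell) → y ≤ x → ∃ λ a → face x a ≡ y
    face-mono  : (x : Cell) (a b : CubeFace (dim x)) → a ≤ᶜ b → face x a ≤ face x b
    face-refl  : (x : Cell) (a b : CubeFace (dim x)) → face x a ≤ face x b → a ≤ᶜ b
    lub : (x y : Cell) → (∃ λ z → x ≤ z × y ≤ z) →
          ∃ λ w → x ≤ w × y ≤ w × ((z : Cell) → x ≤ z → y ≤ z → w ≤ z)

module _ {c ℓ} (K : CubicalComplex c ℓ) where
  open CubicalComplex K

  HasDimension : ℕ → Set c
  HasDimension k = ((x : Cell) → dim x ≤ℕ k) × (∃ λ x → dim x ≡ k)

  VertexEdgeBipartite : Set (c ⊔ ℓ)
  VertexEdgeBipartite =
    ∃ λ (col : Cell → Bool) →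
      (u v e : Cell) → dim u ≡ 0 → dim v ≡ 0 → dim e ≡ 1 →
      u ≤ e → v ≤ e → u ≢ v → col u ≢ col v

  -- An isomorphism of face posets (P_K)_{≤σ₁} → (P_K)_{≤σ₂} is represented,
  -- via the charts, by h : CubeFace (dim σ₁) → CubeFace (dim σ₂), standing
  -- for  face σ₂ ∘ h ∘ (face σ₁)⁻¹.
  Elementary : ℕ → (σ₁ σ₂ : Cell) → (CubeFace (dim σ₁) → CubeFace (dim σ₂)) → Set (c ⊔ ℓ)
  Elementary k σ₁ σ₂ h =
    dim σ₁ ≡ k × dim σ₂ ≡ k × IsCubeIso h ×
    (∃ λ δ → suc (dim δ) ≡ k × δ ≤ σ₁ × δ ≤ σ₂ ×
      ((a : CubeFace (dim σ₁)) → face σ₁ a ≤ δ → face σ₂ (h a) ≡ face σ₁ a))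

  data Morphism (k : ℕ) (σ : Cell) : (τ : Cell) → (CubeFace (dim σ) → CubeFace (dim τ)) → Set (c ⊔ ℓ) where
    idM  : Morphism k σ σ id
    _▷_  : ∀ {τ ρ f g} → Morphism k σ τ f → Elementary k τ ρ g → Morphism k σ ρ (g ∘ f)

  -- I(K) = 0 : every holonomy group Π(K,σ) lies in B_k^even
  -- (read in the chart of σ; evenness is conjugation invariant).
  InvariantZero : ℕ → Set (c ⊔ ℓ)
  InvariantZero k =
    (σ : Cell) → dim σ ≡ k → (h : CubeFace (dim σ) → CubeFace (dim σ)) →
    Morphism k σ σ h → IsEvenSymmetry h

{-# OPTIONS --safe #-}
-- Fix a proper 2-colouring of the vertices of K.  In the chart of a cell x, cube vertices
-- span 0-cells and cube edges span 1-cells of K, so v ↦ colour (face x v) alternates along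
-- the edges of the cube and hence equals (parity of the number of 1s of v) xor a constant.
-- The chart map g of an elementary morphism τ → ρ is a cube isomorphism and so maps cube
-- edges to cube edges; thus v ↦ colour (face ρ (g v)) alternates too, and as it agrees with
-- v ↦ colour (face τ v) at a vertex of the common face δ, the two agree everywhere.  So every
-- morphism preserves vertex colours, and a holonomy h : σ → σ preserves the parity of the
-- number of 1s, i.e. h is even.  Only one vertex of δ is used: neither the dimension of K
-- nor that of δ plays a role.

module Submission where

open import Level using (Level)
open import Algebra.Bundles using (CommutativeRing)
open import Data.Bool using (Bool; false; not; _xor_; if_then_else_)
open import Data.Bool.Properties using (not-involutive; ¬-not; not-distribˡ-xor; xor-∧-commutativeRing)
open import Algebra.Properties.Group (CommutativeRing.+-group xor-∧-commutativeRing) using (∙-cancelˡ; ∙-cancelʳ)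
open import Data.Empty using (⊥; ⊥-elim)
open import Data.Fin using (Fin; _≟_) renaming (zero to fz; suc to fs)
open import Data.Fin.Properties using (¬∀⟶∃¬)
open import Data.Nat using (ℕ; zero; suc; _%_)
open import Data.Product using (Σ; ∃; _×_; _,_; proj₁; proj₂)
open import Data.Sum using (_⊎_; inj₁; inj₂; [_,_]′; map₂)
open import Data.Vec.Functional using (_∷_; head; tail; updateAt)
open import Data.Vec.Functional.Properties using (updateAt-updates; updateAt-minimal)
open import Function using (_∘_; const)
open import Relation.Binary.Definitions using (DecidableEquality)
open import Relation.Binary.PropositionalEquality using (_≡_; _≢_; refl; sym; trans; cong; cong-app; subst; subst₂; ≢-sym; module ≡-Reasoning)
open import Relation.Binary.Structures using (IsPartialOrder)
open import Relation.Nullary using (¬_; yes; no; contradiction)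
open import Defs

open ≡-Reasoning

odd : ℕ → Bool
odd zero    = false
odd (suc n) = not (odd n)

%2≡odd : ∀ n → n % 2 ≡ (if odd n then 1 else 0)
%2≡odd zero          = refl
%2≡odd (suc zero)    = refl
%2≡odd (suc (suc n)) rewrite not-involutive (odd n) = %2≡odd n

odd-≡⇒%2-≡ : ∀ {m n} → odd m ≡ odd n → m % 2 ≡ n % 2
odd-≡⇒%2-≡ {m} {n} eq = begin
  m % 2                    ≡⟨ %2≡odd m ⟩
  (if odd m then 1 else 0) ≡⟨ cong (λ b → if b then 1 else 0) eq ⟩
  (if odd n then 1 else 0) ≡⟨ %2≡odd n ⟨
  n % 2                    ∎

_≟ᵀ_ : DecidableEquality Tri
t0   ≟ᵀ t0   = yes refl
t1   ≟ᵀ t1   = yes refl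
star ≟ᵀ star = yes refl
t0   ≟ᵀ t1   = no λ ()
t0   ≟ᵀ star = no λ ()
t1   ≟ᵀ t0   = no λ ()
t1   ≟ᵀ star = no λ ()
star ≟ᵀ t0   = no λ ()
star ≟ᵀ t1   = no λ ()

module _ {q : ℕ} where

  infix 4 _≈ᶜ_

  _≈ᶜ_ : CubeFace q → CubeFace q → Set
  x ≈ᶜ y = ∀ i → x i ≡ y i

  ≈ᶜ-sym : ∀ {x y} → x ≈ᶜ y → y ≈ᶜ x
  ≈ᶜ-sym x≈y i = sym (x≈y i)

  ≈ᶜ-trans : ∀ {x y z} → x ≈ᶜ y → y ≈ᶜ z → x ≈ᶜ z
  ≈ᶜ-trans x≈y y≈z i = trans (x≈y i) (y≈z i)

  ≈⇒≤ᶜ : ∀ {x y} → x ≈ᶜ y → x ≤ᶜ y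
  ≈⇒≤ᶜ x≈y i = inj₂ (x≈y i)

  ≤ᶜ-trans : ∀ {x y z : CubeFace q} → x ≤ᶜ y → y ≤ᶜ z → x ≤ᶜ z
  ≤ᶜ-trans x≤y y≤z i with x≤y i | y≤z i
  ... | _             | inj₁ zᵢ≡star = inj₁ zᵢ≡star
  ... | inj₁ yᵢ≡star  | inj₂ yᵢ≡zᵢ   = inj₁ (trans (sym yᵢ≡zᵢ) yᵢ≡star)
  ... | inj₂ xᵢ≡yᵢ    | inj₂ yᵢ≡zᵢ   = inj₂ (trans xᵢ≡yᵢ yᵢ≡zᵢ)

  ≤ᶜ-antisym : ∀ {x y} → x ≤ᶜ y → y ≤ᶜ x → x ≈ᶜ y
  ≤ᶜ-antisym x≤y y≤x i with x≤y i | y≤x i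
  ... | inj₂ xᵢ≡yᵢ   | _            = xᵢ≡yᵢ
  ... | inj₁ _       | inj₂ yᵢ≡xᵢ   = sym yᵢ≡xᵢ
  ... | inj₁ yᵢ≡star | inj₁ xᵢ≡star = trans xᵢ≡star (sym yᵢ≡star)

  ≰ᶜ-at : ∀ {x y : CubeFace q} i → y i ≢ star → x i ≢ y i → ¬ x ≤ᶜ y
  ≰ᶜ-at i yᵢ≢star xᵢ≢yᵢ x≤y = [ yᵢ≢star , xᵢ≢yᵢ ]′ (x≤y i)

  origin : CubeFace q
  origin = const t0

  set : CubeFace q → Fin q → Tri → CubeFace q
  set x i t = updateAt x i (const t)

  vertex-resp-≈ : ∀ {x y} → x ≈ᶜ y → IsCubeVertex y → IsCubeVertex x
  vertex-resp-≈ x≈y y-vertex i xᵢ≡star = y-vertex i (trans (sym (x≈y i)) xᵢ≡star)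

  Minimal : CubeFace q → Set
  Minimal x = ∀ {y} → y ≤ᶜ x → y ≈ᶜ x

  vertex⇒minimal : ∀ {v} → IsCubeVertex v → Minimal v
  vertex⇒minimal v-vertex {y} y≤v i with y≤v i
  ... | inj₁ vᵢ≡star = ⊥-elim (v-vertex i vᵢ≡star)
  ... | inj₂ yᵢ≡vᵢ   = yᵢ≡vᵢ

  minimal⇒vertex : ∀ {v} → Minimal v → IsCubeVertex v
  minimal⇒vertex {v} v-minimal i vᵢ≡star = contradiction t0≡star λ ()
    where
    lowered≤v : set v i t0 ≤ᶜ v
    lowered≤v j with j ≟ i
    ... | yes refl = inj₁ vᵢ≡star
    ... | no j≢i   = inj₂ (updateAt-minimal j i v j≢i)

    t0≡star : t0 ≡ star
    t0≡star = begin
      t0             ≡⟨ updateAt-updates i v ⟨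
      set v i t0 i   ≡⟨ v-minimal lowered≤v i ⟩
      v i            ≡⟨ vᵢ≡star ⟩
      star           ∎

  floor : CubeFace q → CubeFace q
  floor x i with x i
  ... | t1 = t1
  ... | _  = t0

  floor-vertex : ∀ x → IsCubeVertex (floor x)
  floor-vertex x i with x i
  ... | t0   = λ ()
  ... | t1   = λ ()
  ... | star = λ ()

  floor-≤ : ∀ x → floor x ≤ᶜ x
  floor-≤ x i with x i
  ... | t0   = inj₂ refl
  ... | t1   = inj₂ refl
  ... | star = inj₁ refl

  Adjacent : CubeFace q → CubeFace q → Fin q → Set
  Adjacent v w i = v i ≡ t0 × w i ≡ t1 × (∀ j → j ≢ i → v j ≡ w j)

  edge : CubeFace q → Fin q → CubeFace q
  edge v i = set v i star

  ≤-edge : ∀ {v i} → v ≤ᶜ edge v i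
  ≤-edge {v} {i} j with j ≟ i
  ... | yes refl = inj₁ (updateAt-updates i v)
  ... | no j≢i   = inj₂ (sym (updateAt-minimal j i v j≢i))

  adjacent-≤-edge : ∀ {v w i} → Adjacent v w i → w ≤ᶜ edge v i
  adjacent-≤-edge {v} {w} {i} (_ , _ , v≡w) j with j ≟ i
  ... | yes refl = inj₁ (updateAt-updates i v)
  ... | no j≢i   = inj₂ (trans (sym (v≡w j j≢i)) (sym (updateAt-minimal j i v j≢i)))

  adjacent-≰ : ∀ {v w i} → Adjacent v w i → ¬ v ≤ᶜ w
  adjacent-≰ {i = i} (vᵢ≡t0 , wᵢ≡t1 , _) =
    ≰ᶜ-at i (λ wᵢ≡star → contradiction (trans (sym wᵢ≡t1) wᵢ≡star) λ ())
            (λ vᵢ≡wᵢ → contradiction (trans (sym vᵢ≡t0) (trans vᵢ≡wᵢ wᵢ≡t1)) λ ())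

  vertex-≤-edge : ∀ {v w i y} → IsCubeVertex v → Adjacent v w i →
    IsCubeVertex y → y ≤ᶜ edge v i → y ≈ᶜ v ⊎ y ≈ᶜ w
  vertex-≤-edge {v} {w} {i} {y} v-vertex (vᵢ≡t0 , wᵢ≡t1 , v≡w) y-vertex y≤e = by-yᵢ (y i) refl
    where
    off-i : ∀ j → j ≢ i → y j ≡ v j
    off-i j j≢i with y≤e j
    ... | inj₁ eⱼ≡star = ⊥-elim (v-vertex j (trans (sym (updateAt-minimal j i v j≢i)) eⱼ≡star))
    ... | inj₂ yⱼ≡eⱼ   = trans yⱼ≡eⱼ (updateAt-minimal j i v j≢i)

    agrees : ∀ {z} → y i ≡ z i → (∀ j → j ≢ i → v j ≡ z j) → y ≈ᶜ z
    agrees at-i off j with j ≟ i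
    ... | yes refl = at-i
    ... | no j≢i   = trans (off-i j j≢i) (off j j≢i)

    by-yᵢ : ∀ t → y i ≡ t → y ≈ᶜ v ⊎ y ≈ᶜ w
    by-yᵢ t0   yᵢ≡t0   = inj₁ (agrees (trans yᵢ≡t0 (sym vᵢ≡t0)) (λ _ _ → refl))
    by-yᵢ t1   yᵢ≡t1   = inj₂ (agrees (trans yᵢ≡t1 (sym wᵢ≡t1)) v≡w)
    by-yᵢ star yᵢ≡star = ⊥-elim (y-vertex i yᵢ≡star)

  -- At a coordinate i where a and b differ, e i = star; so replacing a i by b i gives
  -- a vertex below e, which must be b, hence a and b differ only at i.
  two-vertices-below⇒adjacent : ∀ {a b e} → IsCubeVertex a → IsCubeVertex b →
    a ≤ᶜ e → b ≤ᶜ e → (∀ {y} → IsCubeVertex y → y ≤ᶜ e → y ≈ᶜ a ⊎ y ≈ᶜ b) →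
    ¬ a ≈ᶜ b → ∃ λ i → Adjacent a b i ⊎ Adjacent b a i
  two-vertices-below⇒adjacent {a} {b} {e} a-vertex b-vertex a≤e b≤e only-a-b a≉b =
    i , orient (a i) (b i) refl refl
    where
    differ = ¬∀⟶∃¬ q (λ i → a i ≡ b i) (λ i → a i ≟ᵀ b i) a≉b
    i = proj₁ differ
    aᵢ≢bᵢ = proj₂ differ

    eᵢ≡star : e i ≡ star
    eᵢ≡star with a≤e i | b≤e i
    ... | inj₁ eᵢ≡star | _            = eᵢ≡star
    ... | inj₂ _       | inj₁ eᵢ≡star = eᵢ≡star
    ... | inj₂ aᵢ≡eᵢ   | inj₂ bᵢ≡eᵢ   = ⊥-elim (aᵢ≢bᵢ (trans aᵢ≡eᵢ (sym bᵢ≡eᵢ)))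

    y = set a i (b i)

    y-vertex : IsCubeVertex y
    y-vertex j with j ≟ i
    ... | yes refl = b-vertex i ∘ trans (sym (updateAt-updates i a))
    ... | no j≢i   = a-vertex j ∘ trans (sym (updateAt-minimal j i a j≢i))

    y≤e : y ≤ᶜ e
    y≤e j with j ≟ i
    ... | yes refl = inj₁ eᵢ≡star
    ... | no j≢i   = map₂ (trans (updateAt-minimal j i a j≢i)) (a≤e j)

    agree-off-i : ∀ j → j ≢ i → a j ≡ b j
    agree-off-i with only-a-b y-vertex y≤e
    ... | inj₁ y≈a = ⊥-elim (aᵢ≢bᵢ (trans (sym (y≈a i)) (updateAt-updates i a)))
    ... | inj₂ y≈b = λ j j≢i → trans (sym (updateAt-minimal j i a j≢i)) (y≈b j)

    orient : ∀ s t → a i ≡ s → b i ≡ t → Adjacent a b i ⊎ Adjacent b a i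
    orient t0   t1   aᵢ≡s bᵢ≡t = inj₁ (aᵢ≡s , bᵢ≡t , agree-off-i)
    orient t1   t0   aᵢ≡s bᵢ≡t = inj₂ (bᵢ≡t , aᵢ≡s , λ j j≢i → sym (agree-off-i j j≢i))
    orient t0   t0   aᵢ≡s bᵢ≡t = ⊥-elim (aᵢ≢bᵢ (trans aᵢ≡s (sym bᵢ≡t)))
    orient t1   t1   aᵢ≡s bᵢ≡t = ⊥-elim (aᵢ≢bᵢ (trans aᵢ≡s (sym bᵢ≡t)))
    orient star _    aᵢ≡s _    = ⊥-elim (a-vertex i aᵢ≡s)
    orient t0   star _    bᵢ≡t = ⊥-elim (b-vertex i bᵢ≡t)
    orient t1   star _    bᵢ≡t = ⊥-elim (b-vertex i bᵢ≡t)

  Extensional : (CubeFace q → Bool) → Set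
  Extensional F = ∀ {x y} → x ≈ᶜ y → F x ≡ F y

  Alternating : (CubeFace q → Bool) → Set
  Alternating F = ∀ {v w i} → IsCubeVertex v → IsCubeVertex w → Adjacent v w i → F v ≢ F w

ones-η : ∀ {q} (v : CubeFace (suc q)) → ones v ≡ ones (head v ∷ tail v)
ones-η v with v fz
... | t0   = refl
... | t1   = refl
... | star = refl

alternating≡odd-xor : ∀ {q} {F : CubeFace q → Bool} → Extensional F → Alternating F →
  ∀ {v} → IsCubeVertex v → F v ≡ odd (ones v) xor F origin
alternating≡odd-xor {zero}  F-ext _     _ = F-ext λ ()
alternating≡odd-xor {suc q} {F} F-ext F-alt {v} v-vertex = begin
  F v                                        ≡⟨ F-ext (λ { fz → refl ; (fs _) → refl }) ⟩
  F (head v ∷ tail v)                        ≡⟨ on-cons (head v) (vertex-resp-≈ (λ { fz → refl ; (fs _) → refl }) v-vertex) ⟩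
  odd (ones (head v ∷ tail v)) xor F origin  ≡⟨ cong (λ n → odd n xor F origin) (ones-η v) ⟨
  odd (ones v) xor F origin                  ∎
  where
  t0∷-vertex : ∀ {r : CubeFace q} → IsCubeVertex r → IsCubeVertex (t0 ∷ r)
  t0∷-vertex r-vertex fz     ()
  t0∷-vertex r-vertex (fs j) = r-vertex j

  t0∷-alternating : Alternating (F ∘ (t0 ∷_))
  t0∷-alternating r-vertex s-vertex (rᵢ≡t0 , sᵢ≡t1 , r≡s) =
    F-alt (t0∷-vertex r-vertex) (t0∷-vertex s-vertex)
      (rᵢ≡t0 , sᵢ≡t1 , λ { fz _ → refl ; (fs j) j≢i → r≡s j (j≢i ∘ cong fs) })

  on-t0 : ∀ {r} → IsCubeVertex r → F (t0 ∷ r) ≡ odd (ones r) xor F origin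
  on-t0 {r} r-vertex = begin
    F (t0 ∷ r)                     ≡⟨ alternating≡odd-xor (λ r≈s → F-ext λ { fz → refl ; (fs j) → r≈s j })
                                                          t0∷-alternating r-vertex ⟩
    odd (ones r) xor F (t0 ∷ origin) ≡⟨ cong (odd (ones r) xor_) (F-ext λ { fz → refl ; (fs _) → refl }) ⟩
    odd (ones r) xor F origin      ∎

  on-cons : ∀ t {r} → IsCubeVertex (t ∷ r) → F (t ∷ r) ≡ odd (ones (t ∷ r)) xor F origin
  on-cons t0   t∷r-vertex = on-t0 (t∷r-vertex ∘ fs)
  on-cons t1   {r} t∷r-vertex = begin
    F (t1 ∷ r)                      ≡⟨ ¬-not (≢-sym (F-alt (t0∷-vertex r-vertex) t∷r-vertex t0∷r-adjacent)) ⟩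
    not (F (t0 ∷ r))                ≡⟨ cong not (on-t0 r-vertex) ⟩
    not (odd (ones r) xor F origin) ≡⟨ not-distribˡ-xor (odd (ones r)) (F origin) ⟩
    not (odd (ones r)) xor F origin ∎
    where
    r-vertex = t∷r-vertex ∘ fs
    t0∷r-adjacent : Adjacent (t0 ∷ r) (t1 ∷ r) fz
    t0∷r-adjacent = refl , refl , λ { fz 0≢0 → ⊥-elim (0≢0 refl) ; (fs _) _ → refl }
  on-cons star t∷r-vertex = ⊥-elim (t∷r-vertex fz refl)

alternating-agree : ∀ {q} {F G : CubeFace q → Bool} →
  Extensional F → Alternating F → Extensional G → Alternating G →
  ∀ {u} → IsCubeVertex u → F u ≡ G u → ∀ {v} → IsCubeVertex v → F v ≡ G v
alternating-agree {F = F} {G} F-ext F-alt G-ext G-alt {u} u-vertex Fu≡Gu {v} v-vertex = begin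
  F v                        ≡⟨ alternating≡odd-xor F-ext F-alt v-vertex ⟩
  odd (ones v) xor F origin  ≡⟨ cong (odd (ones v) xor_) F-origin≡G-origin ⟩
  odd (ones v) xor G origin  ≡⟨ alternating≡odd-xor G-ext G-alt v-vertex ⟨
  G v                        ∎
  where
  F-origin≡G-origin : F origin ≡ G origin
  F-origin≡G-origin = ∙-cancelˡ (odd (ones u)) (F origin) (G origin) (begin
    odd (ones u) xor F origin  ≡⟨ alternating≡odd-xor F-ext F-alt u-vertex ⟨
    F u                        ≡⟨ Fu≡Gu ⟩
    G u                        ≡⟨ alternating≡odd-xor G-ext G-alt u-vertex ⟩
    odd (ones u) xor G origin  ∎)

alternating-≡⇒odd-≡ : ∀ {q} {F : CubeFace q → Bool} → Extensional F → Alternating F →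
  ∀ {v w} → IsCubeVertex v → IsCubeVertex w → F v ≡ F w → odd (ones v) ≡ odd (ones w)
alternating-≡⇒odd-≡ {F = F} F-ext F-alt {v} {w} v-vertex w-vertex Fv≡Fw =
  ∙-cancelʳ (F origin) (odd (ones v)) (odd (ones w)) (begin
    odd (ones v) xor F origin  ≡⟨ alternating≡odd-xor F-ext F-alt v-vertex ⟨
    F v                        ≡⟨ Fv≡Fw ⟩
    F w                        ≡⟨ alternating≡odd-xor F-ext F-alt w-vertex ⟩
    odd (ones w) xor F origin  ∎)

record IsDownClosedEmbedding {d p} (ψ : CubeFace d → CubeFace p) : Set where
  field
    mono        : ∀ {x y} → x ≤ᶜ y → ψ x ≤ᶜ ψ y
    reflect     : ∀ {x y} → ψ x ≤ᶜ ψ y → x ≤ᶜ y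
    down-closed : ∀ {x c} → c ≤ᶜ ψ x → ∃ λ y → ψ y ≈ᶜ c

  resp-≈ : ∀ {x y} → x ≈ᶜ y → ψ x ≈ᶜ ψ y
  resp-≈ x≈y = ≤ᶜ-antisym (mono (≈⇒≤ᶜ x≈y)) (mono (≈⇒≤ᶜ (≈ᶜ-sym x≈y)))

  preserves-minimal : ∀ {x} → Minimal x → Minimal (ψ x)
  preserves-minimal x-minimal c≤ψx with down-closed c≤ψx
  ... | y , ψy≈c = ≈ᶜ-trans (≈ᶜ-sym ψy≈c)
                     (resp-≈ (x-minimal (reflect (≤ᶜ-trans (≈⇒≤ᶜ ψy≈c) c≤ψx))))

  reflects-minimal : ∀ {x} → Minimal (ψ x) → Minimal x
  reflects-minimal ψx-minimal y≤x = ≤ᶜ-antisym y≤x (reflect (≈⇒≤ᶜ (≈ᶜ-sym (ψx-minimal (mono y≤x)))))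

  preserves-vertex : ∀ {v} → IsCubeVertex v → IsCubeVertex (ψ v)
  preserves-vertex = minimal⇒vertex ∘ preserves-minimal ∘ vertex⇒minimal

  reflects-vertex : ∀ {v} → IsCubeVertex (ψ v) → IsCubeVertex v
  reflects-vertex = minimal⇒vertex ∘ reflects-minimal ∘ vertex⇒minimal

  preserves-adjacency : ∀ {v w i} → IsCubeVertex v → IsCubeVertex w → Adjacent v w i →
    ∃ λ j → Adjacent (ψ v) (ψ w) j ⊎ Adjacent (ψ w) (ψ v) j
  preserves-adjacency {v} {w} {i} v-vertex w-vertex v~w =
    two-vertices-below⇒adjacent (preserves-vertex v-vertex) (preserves-vertex w-vertex)
      (mono ≤-edge) (mono (adjacent-≤-edge v~w)) only-ψv-ψw
      (adjacent-≰ v~w ∘ reflect ∘ ≈⇒≤ᶜ)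
    where
    only-ψv-ψw : ∀ {y} → IsCubeVertex y → y ≤ᶜ ψ (edge v i) → y ≈ᶜ ψ v ⊎ y ≈ᶜ ψ w
    only-ψv-ψw y-vertex y≤ψe with down-closed y≤ψe
    ... | z , ψz≈y with vertex-≤-edge v-vertex v~w
                          (reflects-vertex (vertex-resp-≈ ψz≈y y-vertex))
                          (reflect (≤ᶜ-trans (≈⇒≤ᶜ ψz≈y) y≤ψe))
    ...   | inj₁ z≈v = inj₁ (≈ᶜ-trans (≈ᶜ-sym ψz≈y) (resp-≈ z≈v))
    ...   | inj₂ z≈w = inj₂ (≈ᶜ-trans (≈ᶜ-sym ψz≈y) (resp-≈ z≈w))

  ∘-extensional : ∀ {F} → Extensional F → Extensional (F ∘ ψ)
  ∘-extensional F-ext = F-ext ∘ resp-≈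

  ∘-alternating : ∀ {F} → Alternating F → Alternating (F ∘ ψ)
  ∘-alternating F-alt v-vertex w-vertex v~w with preserves-adjacency v-vertex w-vertex v~w
  ... | _ , inj₁ ψv~ψw = F-alt (preserves-vertex v-vertex) (preserves-vertex w-vertex) ψv~ψw
  ... | _ , inj₂ ψw~ψv = ≢-sym (F-alt (preserves-vertex w-vertex) (preserves-vertex v-vertex) ψw~ψv)

iso⇒down-closed-embedding : ∀ {p q} {g : CubeFace p → CubeFace q} → IsCubeIso g → IsDownClosedEmbedding g
iso⇒down-closed-embedding (g-order , g-onto) = record
  { mono        = λ {x} {y} → proj₁ (g-order x y)
  ; reflect     = λ {x} {y} → proj₂ (g-order x y)
  ; down-closed = λ {c = c} _ → proj₁ (g-onto c) , cong-app (proj₂ (g-onto c))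
  }

dim≡0-below-vertex : ∀ {d p} {ψ : CubeFace d → CubeFace p} → IsDownClosedEmbedding ψ →
  ∀ {v} → IsCubeVertex v → (∀ b → ψ b ≤ᶜ v) → d ≡ 0
dim≡0-below-vertex {zero}  _     _        _     = refl
dim≡0-below-vertex {suc d} ψ-emb v-vertex below =
  ⊥-elim (≰ᶜ-at fz (λ ()) (λ ()) (reflect {const t0} {const t1} (≈⇒≤ᶜ (≈ᶜ-trans ψ0≈v (≈ᶜ-sym ψ1≈v)))))
  where
  open IsDownClosedEmbedding ψ-emb
  ψ0≈v = vertex⇒minimal v-vertex (below (const t0))
  ψ1≈v = vertex⇒minimal v-vertex (below (const t1))

-- In dimension ≥ 2 the cube has three pairwise incomparable vertices, but only two
-- vertices lie below an edge.
dim≡1-onto-edge : ∀ {d p} {ψ : CubeFace d → CubeFace p} → IsDownClosedEmbedding ψ →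
  ∀ {v w i} → IsCubeVertex v → Adjacent v w i →
  (∀ b → ψ b ≤ᶜ edge v i) → (∀ {c} → c ≤ᶜ edge v i → ∃ λ b → ψ b ≈ᶜ c) → d ≡ 1
dim≡1-onto-edge {zero} ψ-emb _ v~w _ onto with onto ≤-edge | onto (adjacent-≤-edge v~w)
... | b , ψb≈v | b′ , ψb′≈w =
  ⊥-elim (adjacent-≰ v~w (≤ᶜ-trans (≈⇒≤ᶜ (≈ᶜ-sym ψb≈v)) (≤ᶜ-trans (mono {b} {b′} λ ()) (≈⇒≤ᶜ ψb′≈w))))
  where open IsDownClosedEmbedding ψ-emb
dim≡1-onto-edge {suc zero}    _     _        _   _     _ = refl
dim≡1-onto-edge {suc (suc d)} {ψ = ψ} ψ-emb {v} {w} v-vertex v~w below _ =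
  ⊥-elim (two-of-three (image p₀-vertex) (image p₁-vertex) (image p₂-vertex))
  where
  open IsDownClosedEmbedding ψ-emb
  p₀ p₁ p₂ : CubeFace (suc (suc d))
  p₀ = origin
  p₁ = t1 ∷ origin
  p₂ = t0 ∷ t1 ∷ origin

  p₀-vertex : IsCubeVertex p₀
  p₀-vertex _ ()
  p₁-vertex : IsCubeVertex p₁
  p₁-vertex fz     ()
  p₁-vertex (fs _) ()
  p₂-vertex : IsCubeVertex p₂
  p₂-vertex fz          ()
  p₂-vertex (fs fz)     ()
  p₂-vertex (fs (fs _)) ()

  image : ∀ {b} → IsCubeVertex b → ψ b ≈ᶜ v ⊎ ψ b ≈ᶜ w
  image {b} b-vertex = vertex-≤-edge v-vertex v~w (preserves-vertex b-vertex) (below b)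

  same-image⇒≤ : ∀ {x y z} → ψ x ≈ᶜ z → ψ y ≈ᶜ z → x ≤ᶜ y
  same-image⇒≤ ψx≈z ψy≈z = reflect (≈⇒≤ᶜ (≈ᶜ-trans ψx≈z (≈ᶜ-sym ψy≈z)))

  p₀≰p₁ : ¬ p₀ ≤ᶜ p₁
  p₀≰p₁ = ≰ᶜ-at fz (λ ()) (λ ())
  p₀≰p₂ : ¬ p₀ ≤ᶜ p₂
  p₀≰p₂ = ≰ᶜ-at (fs fz) (λ ()) (λ ())
  p₁≰p₂ : ¬ p₁ ≤ᶜ p₂
  p₁≰p₂ = ≰ᶜ-at fz (λ ()) (λ ())

  two-of-three : ψ p₀ ≈ᶜ v ⊎ ψ p₀ ≈ᶜ w → ψ p₁ ≈ᶜ v ⊎ ψ p₁ ≈ᶜ w → ψ p₂ ≈ᶜ v ⊎ ψ p₂ ≈ᶜ w → ⊥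
  two-of-three (inj₁ a) (inj₁ b) _        = p₀≰p₁ (same-image⇒≤ a b)
  two-of-three (inj₂ a) (inj₂ b) _        = p₀≰p₁ (same-image⇒≤ a b)
  two-of-three (inj₁ a) (inj₂ _) (inj₁ c) = p₀≰p₂ (same-image⇒≤ a c)
  two-of-three (inj₂ a) (inj₁ _) (inj₂ c) = p₀≰p₂ (same-image⇒≤ a c)
  two-of-three (inj₁ _) (inj₂ b) (inj₂ c) = p₁≰p₂ (same-image⇒≤ b c)
  two-of-three (inj₂ _) (inj₁ b) (inj₁ c) = p₁≰p₂ (same-image⇒≤ b c)

module _ {c ℓ} (K : CubicalComplex c ℓ) where
  open CubicalComplex K
  open IsPartialOrder isPartialOrder using () renaming (refl to ≤-refl; trans to ≤-trans; antisym to ≤-antisym)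

  face-injective : ∀ x {a b} → face x a ≡ face x b → a ≈ᶜ b
  face-injective x {a} {b} fa≡fb = ≤ᶜ-antisym (face-refl x a b (subst (face x a ≤_) fa≡fb ≤-refl))
                                               (face-refl x b a (subst (face x b ≤_) (sym fa≡fb) ≤-refl))

  face-resp-≈ : ∀ x {a b} → a ≈ᶜ b → face x a ≡ face x b
  face-resp-≈ x {a} {b} a≈b = ≤-antisym (face-mono x a b (≈⇒≤ᶜ a≈b)) (face-mono x b a (≈⇒≤ᶜ (≈ᶜ-sym a≈b)))

  module Subface (x : Cell) (a : CubeFace (dim x)) where

    private
      preimage : ∀ b → ∃ λ a′ → face x a′ ≡ face (face x a) b
      preimage b = face-onto x (face (face x a) b) (≤-trans (face-≤ (face x a) b) (face-≤ x a))

    -- the transition map (face x)⁻¹ ∘ face (face x a)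
    chart : CubeFace (dim (face x a)) → CubeFace (dim x)
    chart b = proj₁ (preimage b)

    face-chart : ∀ b → face x (chart b) ≡ face (face x a) b
    face-chart b = proj₂ (preimage b)

    chart-≤ : ∀ b → chart b ≤ᶜ a
    chart-≤ b = face-refl x (chart b) a (subst (_≤ face x a) (sym (face-chart b)) (face-≤ (face x a) b))

    chart-onto : ∀ {c} → c ≤ᶜ a → ∃ λ b → chart b ≈ᶜ c
    chart-onto {c} c≤a with face-onto (face x a) (face x c) (face-mono x c a c≤a)
    ... | b , fb≡fc = b , face-injective x (trans (face-chart b) fb≡fc)

    chart-embedding : IsDownClosedEmbedding chart
    chart-embedding = record
      { mono        = λ {b} {b′} b≤b′ → face-refl x _ _
                        (subst₂ _≤_ (sym (face-chart b)) (sym (face-chart b′)) (face-mono (face x a) b b′ b≤b′))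
      ; reflect     = λ {b} {b′} cb≤cb′ → face-refl (face x a) b b′
                        (subst₂ _≤_ (face-chart b) (face-chart b′) (face-mono x _ _ cb≤cb′))
      ; down-closed = λ {b} c≤cb → chart-onto (≤ᶜ-trans c≤cb (chart-≤ b))
      }

  dim-face-vertex : ∀ x {v} → IsCubeVertex v → dim (face x v) ≡ 0
  dim-face-vertex x {v} v-vertex = dim≡0-below-vertex chart-embedding v-vertex chart-≤
    where open Subface x v

  dim-face-edge : ∀ x {v w i} → IsCubeVertex v → Adjacent v w i → dim (face x (edge v i)) ≡ 1
  dim-face-edge x {v} {i = i} v-vertex v~w = dim≡1-onto-edge chart-embedding v-vertex v~w chart-≤ chart-onto
    where open Subface x (edge v i)

  module _ (bipartite : VertexEdgeBipartite K) where
    open Σ bipartite renaming (proj₁ to colour; proj₂ to colour-proper)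

    colour-extensional : ∀ x → Extensional (colour ∘ face x)
    colour-extensional x = cong colour ∘ face-resp-≈ x

    colour-alternating : ∀ x → Alternating (colour ∘ face x)
    colour-alternating x {v} {w} v-vertex w-vertex v~w =
      colour-proper (face x v) (face x w) (face x (edge v _))
        (dim-face-vertex x v-vertex) (dim-face-vertex x w-vertex) (dim-face-edge x v-vertex v~w)
        (face-mono x _ _ ≤-edge) (face-mono x _ _ (adjacent-≤-edge v~w))
        (adjacent-≰ v~w ∘ ≈⇒≤ᶜ ∘ face-injective x)

    PreservesColour : (σ τ : Cell) → (CubeFace (dim σ) → CubeFace (dim τ)) → Set
    PreservesColour σ τ f = ∀ {v} → IsCubeVertex v → IsCubeVertex (f v) × colour (face τ (f v)) ≡ colour (face σ v)

    elementary-preserves-colour : ∀ {k τ ρ g} → Elementary K k τ ρ g → PreservesColour τ ρ g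
    elementary-preserves-colour {τ = τ} {ρ} {g} (_ , _ , g-iso , δ , _ , δ≤τ , _ , g-fixes-δ) v-vertex =
      preserves-vertex v-vertex ,
      alternating-agree (∘-extensional (colour-extensional ρ)) (∘-alternating (colour-alternating ρ))
                        (colour-extensional τ) (colour-alternating τ)
                        u-vertex (cong colour (g-fixes-δ u u≤δ)) v-vertex
      where
      open IsDownClosedEmbedding (iso⇒down-closed-embedding g-iso)
      a = proj₁ (face-onto τ δ δ≤τ)
      u = floor a
      u-vertex = floor-vertex a
      u≤δ : face τ u ≤ δ
      u≤δ = subst (face τ u ≤_) (proj₂ (face-onto τ δ δ≤τ)) (face-mono τ u a (floor-≤ a))

    morphism-preserves-colour : ∀ {k σ τ f} → Morphism K k σ τ f → PreservesColour σ τ f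
    morphism-preserves-colour idM     v-vertex = v-vertex , refl
    morphism-preserves-colour (m ▷ e) v-vertex =
      let (fv-vertex , fv-colour) = morphism-preserves-colour m v-vertex
          (gfv-vertex , gfv-colour) = elementary-preserves-colour e fv-vertex
      in  gfv-vertex , trans gfv-colour fv-colour

    holonomy-even : ∀ {k σ h} → Morphism K k σ σ h → IsEvenSymmetry h
    holonomy-even {σ = σ} {h} loop v v-vertex =
      odd-≡⇒%2-≡ {ones (h v)} {ones v} (alternating-≡⇒odd-≡ (colour-extensional σ) (colour-alternating σ) hv-vertex v-vertex hv-colour)
      where
      hv = morphism-preserves-colour loop v-vertex
      hv-vertex = proj₁ hv
      hv-colour = proj₂ hv

mainTheorem1 : ∀ {c ℓ : Level} (K : CubicalComplex c ℓ) (k : ℕ) →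
    HasDimension K k → VertexEdgeBipartite K → InvariantZero K k
mainTheorem1 K k _ bipartite σ _ h = holonomy-even K bipartite
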